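{- For each positive integer $k$ there exist unique positive integers $d,r$ with $d$ square-free such that $\eta=\frac{k}{2}+\frac{r}{2}\sqrt{d}$ is a unit of (the ring of integers of) the quadratic field $\mathbb{Q}(\sqrt{d})$ with norm $N(\eta)=\left(\frac{k}{2}\right)^2-\left(\frac{r}{2}\right)^2d=-1$. Moreover, for these $d,r$, the $k$-Fibonacci sequence coincides with the Fibonacci sequence of degree $d$ with respect to the unit $\eta$, i.e. with $(F_{\eta,n})_{n\ge1}$.
   Context: For a positive integer $k$, the $k$-Fibonacci sequence is the sequence $(G_n)_{n\ge1}$ with $G_1=1$, $G_2=k$ and $G_{n+2}=kG_{n+1}+G_n$ for all $n\ge1$. For a unit $\eta=\alpha+\beta\sqrt d$ of $\mathbb{Q}(\sqrt d)$ with $\alpha,\beta\in\mathbb{Q}$, $\beta\neq0$, write $\eta^n=\alpha_n+\beta_n\sqrt d$ ($\alpha_n,\beta_n\in\mathbb{Q}$) for $n\ge1$; the Fibonacci sequence of degree $d$ with respect to $\eta$ is $F_{\eta,n}=\beta_n/\beta$, $n\ge1$. -}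

module Defs where

open import Data.Nat as ℕ using (ℕ; zero; suc)
open import Data.Nat.Divisibility using (_∣_)
open import Data.Integer as ℤ using (ℤ; +_)
open import Data.Rational as ℚ using (ℚ; 0ℚ; 1ℚ; _/_; _÷_; ≢-nonZero)
open import Data.Rational.Properties using () renaming (_≟_ to _≟ℚ_)
open import Data.List using (List; []; _∷_)
open import Data.Product using (Σ; _×_; _,_)
open import Relation.Binary.PropositionalEquality using (_≡_)
open import Relation.Nullary using (yes; no)

-- k-Fibonacci sequence, indexed so that kFib k 1 = 1, kFib k 2 = k,
-- kFib k (n+2) = k * kFib k (n+1) + kFib k n.  (kFib k 0 = 0 is an
-- auxiliary value consistent with the recurrence; only n ≥ 1 is used.)
kFib : ℕ → ℕ → ℕ
kFib k zero = 0
kFib k (suc zero) = 1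
kFib k (suc (suc n)) = k ℕ.* kFib k (suc n) ℕ.+ kFib k n

SquareFree : ℕ → Set
SquareFree d = ∀ m → m ℕ.* m ∣ d → m ≡ 1

-- Elements α + β√d of ℚ(√d), represented as pairs (α , β) of rationals.
QF : Set
QF = ℚ × ℚ

ℚof : ℤ → ℚ
ℚof z = z / 1

module _ (d : ℕ) where
  dℚ : ℚ
  dℚ = + d / 1

  qmul : QF → QF → QF
  qmul (a , b) (c , e) = (a ℚ.* c ℚ.+ b ℚ.* e ℚ.* dℚ) , (a ℚ.* e ℚ.+ b ℚ.* c)

  qadd : QF → QF → QF
  qadd (a , b) (c , e) = (a ℚ.+ c) , (b ℚ.+ e)

  qone : QF
  qone = 1ℚ , 0ℚ

  qzero : QF
  qzero = 0ℚ , 0ℚ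

  qint : ℤ → QF
  qint z = ℚof z , 0ℚ

  qpow : QF → ℕ → QF
  qpow η zero = qone
  qpow η (suc n) = qmul η (qpow η n)

  -- value at x of the monic integer polynomial
  --   x^m + c_{m-1} x^{m-1} + … + c_1 x + c_0   where cs = c_0 ∷ … ∷ c_{m-1}
  evalMonic : List ℤ → QF → QF
  evalMonic [] x = qone
  evalMonic (c ∷ cs) x = qadd (qint c) (qmul x (evalMonic cs x))

  IsAlgInt : QF → Set
  IsAlgInt η = Σ (List ℤ) λ cs → evalMonic cs η ≡ qzero

  IsUnit : QF → Set
  IsUnit η = IsAlgInt η × Σ QF λ μ → IsAlgInt μ × qmul η μ ≡ qone

  qnorm : QF → ℚ
  qnorm (a , b) = a ℚ.* a ℚ.- b ℚ.* b ℚ.* dℚ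

  -- Fibonacci sequence of degree d w.r.t. η = α + β√d:  F_{η,n} = β_n / β,
  -- where η^n = α_n + β_n √d.  (β ≠ 0 is assumed in the paper; for β = 0 we
  -- return the junk value 0.)
  FibDeg : QF → ℕ → ℚ
  FibDeg (a , b) n with b ≟ℚ 0ℚ
  ... | yes _ = 0ℚ
  ... | no b≢0 with qpow (a , b) n
  ... | (_ , bn) = _÷_ bn b {{≢-nonZero b≢0}}

etaOf : ℕ → ℕ → QF
etaOf k r = (+ k / 2) , (+ r / 2)

Good : ℕ → ℕ → ℕ → Set
Good k d r = 0 ℕ.< d × 0 ℕ.< r × SquareFree d
           × IsUnit d (etaOf k r)
           × qnorm d (etaOf k r) ≡ ℚ.- 1ℚ

-- N(k/2 + (r/2)√d) = −1 says exactly r² d = k² + 4, so (d, r) must be the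
-- square-free factorisation of k² + 4: it exists by repeatedly dividing out a
-- square, and it is unique because after dividing r and s by their gcd the
-- coprime quotients x, y satisfy x² d = y² e, forcing x² ∣ e, i.e. x = 1.
-- An element of trace k and norm −1 is a root of X² − kX − 1, and its inverse
-- −η̄ a root of X² + kX − 1, so η is a unit; and η² = kη + 1 gives
-- η^(n+1) = G_n + G_(n+1) η, whose √d-coefficient is G_(n+1) · r/2.
module Submission where

open import Defs
open import Data.Nat using (ℕ; _<_; _≤_)
open import Data.Rational using (_/_)
open import Data.Integer using (+_)
open import Data.Product using (Σ; _×_; _,_)
open import Relation.Binary.PropositionalEquality using (_≡_; _≢_)

open import Data.Nat as ℕ using (zero; suc; _+_; _*_; z≤n; s≤s; NonZero; NonTrivial)
open import Data.Nat.Properties as ℕP using (anyUpTo?; nonTrivial?)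
open import Data.Nat.Divisibility
open import Data.Nat.DivMod using (m/n*n≡m)
open import Data.Nat.GCD using (gcd; gcd[m,n]∣m; gcd[m,n]∣n; gcd[m,n]≡0⇒m≡0; m/gcd[m,n]≢0; n/gcd[m,n]≢0)
open import Data.Nat.Coprimality using (Coprime; coprime-divisor; coprime-/gcd)
import Data.Nat.Coprimality as Coprime
open import Data.Nat.Induction using (<-rec)
open import Data.Nat.Tactic.RingSolver using (solve-∀)
open import Data.Integer as ℤ using (ℤ; 0ℤ; -[1+_])
import Data.Integer.Properties as ℤP
open import Data.Integer.GCD using () renaming (gcd to gcdℤ)
open import Data.Rational as ℚ using (ℚ; mkℚ; 0ℚ; 1ℚ)
open import Data.Rational.Properties as ℚP using (normalize-coprime; ↥-/)
open import Data.Rational.Solver using (module +-*-Solver)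
open import Algebra.Properties.Group ℚP.+-0-group using (x∙y⁻¹≈ε⇒x≈y)
open import Data.List using ([]; _∷_)
open import Data.Product using (∃; proj₂; swap)
open import Function.Bundles using (_⇔_; mk⇔; module Equivalence)
open import Relation.Nullary using (Dec; ¬_; yes; no; contradiction)
open import Relation.Nullary.Decidable using (_×-dec_)
open import Relation.Binary.PropositionalEquality
  using (refl; sym; trans; cong; cong₂; subst; module ≡-Reasoning)

open +-*-Solver using (solve; _:=_; _:+_; _:*_; _:-_; :-_; con)
open ≡-Reasoning

fromℕ : ℕ → ℚ
fromℕ n = ℚof (+ n)

fromℕ≡mkℚ : ∀ n → fromℕ n ≡ mkℚ (+ n) 0 (Coprime.sym (Coprime.1-coprimeTo n))
fromℕ≡mkℚ n = normalize-coprime (Coprime.sym (Coprime.1-coprimeTo n))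

fromℕ-+ : ∀ m n → fromℕ (m + n) ≡ fromℕ m ℚ.+ fromℕ n
fromℕ-+ m n = begin
  + (m + n) / 1                           ≡⟨ cong (_/ 1) (ℤP.pos-+ m n) ⟩
  (+ m ℤ.+ + n) / 1                       ≡⟨ cong (_/ 1) (sym (cong₂ ℤ._+_ (ℤP.*-identityʳ (+ m)) (ℤP.*-identityʳ (+ n)))) ⟩
  (+ m ℤ.* + 1 ℤ.+ + n ℤ.* + 1) / 1       ≡⟨ sym (cong₂ ℚ._+_ (fromℕ≡mkℚ m) (fromℕ≡mkℚ n)) ⟩
  fromℕ m ℚ.+ fromℕ n                     ∎

fromℕ-* : ∀ m n → fromℕ (m * n) ≡ fromℕ m ℚ.* fromℕ n
fromℕ-* m n = trans (cong (_/ 1) (ℤP.pos-* m n)) (sym (cong₂ ℚ._*_ (fromℕ≡mkℚ m) (fromℕ≡mkℚ n)))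

fromℕ-injective : ∀ {m n} → fromℕ m ≡ fromℕ n → m ≡ n
fromℕ-injective {m} {n} eq =
  ℤP.+-injective (cong ℚ.↥_ (trans (sym (fromℕ≡mkℚ m)) (trans eq (fromℕ≡mkℚ n))))

½ ¼ : ℚ
½ = + 1 / 2
¼ = + 1 / 4

n/2≡fromℕ*½ : ∀ n → + n / 2 ≡ fromℕ n ℚ.* ½
n/2≡fromℕ*½ n = sym (trans (cong (ℚ._* ½) (fromℕ≡mkℚ n)) (cong (_/ 2) (ℤP.*-identityʳ (+ n))))

ℚof-neg : ∀ i → ℚof (ℤ.- i) ≡ ℚ.- ℚof i
ℚof-neg (+ zero)  = refl
ℚof-neg (+ suc n) = refl
ℚof-neg -[1+ n ]  = solve 1 (λ x → x := :- (:- x)) refl (ℚof (+ suc n))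

/≢0 : ∀ {i d} .{{_ : NonZero d}} → i ≢ 0ℤ → i / d ≢ 0ℚ
/≢0 {i} {d} i≢0 i/d≡0 = i≢0 (trans (sym (↥-/ i d)) (cong (λ p → ℚ.↥ p ℤ.* gcdℤ i (+ d)) i/d≡0))

SquareFreeFactorisation : ℕ → Set
SquareFreeFactorisation N = Σ ℕ λ r → Σ ℕ λ d → 0 < r × 0 < d × SquareFree d × r * r * d ≡ N

NonTrivialSquareDivisor : ℕ → Set
NonTrivialSquareDivisor N = ∃ λ m → m < suc N × NonTrivial m × m * m ∣ N

nonTrivialSquareDivisor? : ∀ N → Dec (NonTrivialSquareDivisor N)
nonTrivialSquareDivisor? N = anyUpTo? (λ m → nonTrivial? m ×-dec m * m ∣? N) (suc N)

¬nonTrivialSquareDivisor⇒squareFree : ∀ {N} → 0 < N → ¬ NonTrivialSquareDivisor N → SquareFree N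
¬nonTrivialSquareDivisor⇒squareFree N>0 ∄m zero 0∣N = contradiction (0∣⇒≡0 0∣N) (ℕP.>⇒≢ N>0)
¬nonTrivialSquareDivisor⇒squareFree N>0 ∄m (suc zero) _ = refl
¬nonTrivialSquareDivisor⇒squareFree {suc N} _ ∄m m@(suc (suc _)) m²∣N =
  contradiction (m , s≤s (ℕP.≤-trans (ℕP.m≤m*n m m) (∣⇒≤ m²∣N)) , _ , m²∣N) ∄m

squareFreeFactorisation : ∀ N → 0 < N → SquareFreeFactorisation N
squareFreeFactorisation = <-rec (λ N → 0 < N → SquareFreeFactorisation N) factorise
  where
  factorise : ∀ N → (∀ {M} → M < N → 0 < M → SquareFreeFactorisation M) → 0 < N → SquareFreeFactorisation N
  factorise N rec N>0 with nonTrivialSquareDivisor? N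
  ... | no ∄m = 1 , N , s≤s z≤n , N>0 , ¬nonTrivialSquareDivisor⇒squareFree N>0 ∄m , ℕP.+-identityʳ N
  ... | yes (m@(suc (suc _)) , _ , _ , divides q N≡qm²) with rec q<N q>0
    where
    q>0 : 0 < q
    q>0 = ℕP.n≢0⇒n>0 λ { refl → ℕP.>⇒≢ N>0 N≡qm² }
    q<N : q < N
    q<N = subst (q <_) (sym N≡qm²) (ℕP.m<m*n q (m * m) {{ℕ.>-nonZero q>0}} (s≤s (s≤s z≤n)))
  ... | r , d , r>0 , d>0 , sf , r²d≡q = r * m , d , rm>0 , d>0 , sf , (begin
    r * m * (r * m) * d   ≡⟨ regroup r m d ⟩
    r * r * d * (m * m)   ≡⟨ cong (_* (m * m)) r²d≡q ⟩
    q * (m * m)           ≡⟨ sym N≡qm² ⟩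
    N                     ∎)
    where
    rm>0 : 0 < r * m
    rm>0 = ℕ.>-nonZero⁻¹ (r * m) {{ℕP.m*n≢0 r m {{ℕ.>-nonZero r>0}}}}
    regroup : ∀ r m d → r * m * (r * m) * d ≡ r * r * d * (m * m)
    regroup = solve-∀

coprime-divisor² : ∀ {x y q} → Coprime x y → x ∣ y * y * q → x ∣ q
coprime-divisor² {x} {y} {q} cop x∣y²q =
  coprime-divisor cop (coprime-divisor cop (subst (x ∣_) (ℕP.*-assoc y y q) x∣y²q))

coprime-square-divisor : ∀ {x y q} .{{_ : NonZero x}} → Coprime x y → x * x ∣ y * y * q → x * x ∣ q
coprime-square-divisor {x} {y} {q} cop x²∣y²q =
  subst (x * x ∣_) (sym q≡q′x) (*-monoˡ-∣ x (coprime-divisor² cop (*-cancelʳ-∣ x x²∣y²q′x)))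
  where
  x∣q : x ∣ q
  x∣q = coprime-divisor² cop (∣-trans (m∣m*n x) x²∣y²q)
  open _∣_ x∣q renaming (quotient to q′; equality to q≡q′x)
  x²∣y²q′x : x * x ∣ y * y * q′ * x
  x²∣y²q′x = subst (x * x ∣_) (trans (cong (y * y *_) q≡q′x) (sym (ℕP.*-assoc (y * y) q′ x))) x²∣y²q

coprime-squareFree⇒≡1 : ∀ {x y p q} → 0 < x → Coprime x y → x * x * p ≡ y * y * q → SquareFree q → x ≡ 1
coprime-squareFree⇒≡1 {x} {p = p} x>0 cop x²p≡y²q sf =
  sf x (coprime-square-divisor {{ℕ.>-nonZero x>0}} cop (divides p (trans (sym x²p≡y²q) (ℕP.*-comm (x * x) p))))

squareFreeFactorisation-unique : ∀ {r d s e} → 0 < r → 0 < s → SquareFree d → SquareFree e →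
                                 r * r * d ≡ s * s * e → r ≡ s × d ≡ e
squareFreeFactorisation-unique {r} {d} {s} {e} r>0 s>0 sfd sfe r²d≡s²e = r≡s , d≡e
  where
  instance
    r≢0 = ℕ.>-nonZero r>0
    s≢0 = ℕ.>-nonZero s>0
    g≢0 = ℕ.≢-nonZero (λ g≡0 → ℕP.>⇒≢ r>0 (gcd[m,n]≡0⇒m≡0 g≡0))
  g = gcd r s
  r′ = r ℕ./ g
  s′ = s ℕ./ g
  r≡r′g : r ≡ r′ * g
  r≡r′g = sym (m/n*n≡m (gcd[m,n]∣m r s))
  s≡s′g : s ≡ s′ * g
  s≡s′g = sym (m/n*n≡m (gcd[m,n]∣n r s))
  regroup : ∀ a g d → a * g * (a * g) * d ≡ g * g * (a * a * d)
  regroup = solve-∀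
  r′²d≡s′²e : r′ * r′ * d ≡ s′ * s′ * e
  r′²d≡s′²e = ℕP.*-cancelˡ-≡ _ _ (g * g) {{ℕP.m*n≢0 g g}} (begin
    g * g * (r′ * r′ * d)   ≡⟨ sym (regroup r′ g d) ⟩
    r′ * g * (r′ * g) * d   ≡⟨ cong (λ x → x * x * d) (sym r≡r′g) ⟩
    r * r * d               ≡⟨ r²d≡s²e ⟩
    s * s * e               ≡⟨ cong (λ x → x * x * e) s≡s′g ⟩
    s′ * g * (s′ * g) * e   ≡⟨ regroup s′ g e ⟩
    g * g * (s′ * s′ * e)   ∎)
  r′≡1 : r′ ≡ 1
  r′≡1 = coprime-squareFree⇒≡1 (ℕP.n≢0⇒n>0 (m/gcd[m,n]≢0 r s)) (coprime-/gcd r s) r′²d≡s′²e sfe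
  s′≡1 : s′ ≡ 1
  s′≡1 = coprime-squareFree⇒≡1 (ℕP.n≢0⇒n>0 (n/gcd[m,n]≢0 r s)) (Coprime.sym (coprime-/gcd r s)) (sym r′²d≡s′²e) sfd
  r≡s : r ≡ s
  r≡s = trans r≡r′g (trans (cong (_* g) (trans r′≡1 (sym s′≡1))) (sym s≡s′g))
  d≡e : d ≡ e
  d≡e = ℕP.*-cancelˡ-≡ d e (r * r) {{ℕP.m*n≢0 r r}} (trans r²d≡s²e (cong (λ x → x * x * e) (sym r≡s)))

module _ (d : ℕ) where

  qmul-identityʳ : ∀ η → qmul d η (qone d) ≡ η
  qmul-identityʳ (a , b) = cong₂ _,_
    (solve 3 (λ a b D → a :* con 1ℚ :+ b :* con 0ℚ :* D := a) refl a b (dℚ d))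
    (solve 2 (λ a b → a :* con 0ℚ :+ b :* con 1ℚ := b) refl a b)

  qmul-cayleyHamilton : ∀ a b → qmul d (a , b) (qadd d (ℚ.- (a ℚ.+ a) , 0ℚ) (a , b)) ≡ (ℚ.- qnorm d (a , b) , 0ℚ)
  qmul-cayleyHamilton a b = cong₂ _,_
    (solve 3 (λ a b D → a :* (:- (a :+ a) :+ a) :+ b :* (con 0ℚ :+ b) :* D := :- (a :* a :- b :* b :* D)) refl a b (dℚ d))
    (solve 2 (λ a b → a :* (con 0ℚ :+ b) :+ b :* (:- (a :+ a) :+ a) := con 0ℚ) refl a b)

  trace∧norm-integral⇒isAlgInt : ∀ a b (c₀ c₁ : ℤ) → ℚof c₀ ≡ qnorm d (a , b) → ℚof c₁ ≡ ℚ.- (a ℚ.+ a) →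
                                 IsAlgInt d (a , b)
  trace∧norm-integral⇒isAlgInt a b c₀ c₁ c₀≡N c₁≡-Tr = c₀ ∷ c₁ ∷ [] , (begin
    qadd d (qint d c₀) (qmul d η (qadd d (qint d c₁) (qmul d η (qone d))))
      ≡⟨ cong₂ (λ n t → qadd d (n , 0ℚ) (qmul d η (qadd d (t , 0ℚ) (qmul d η (qone d))))) c₀≡N c₁≡-Tr ⟩
    qadd d (N , 0ℚ) (qmul d η (qadd d (ℚ.- (a ℚ.+ a) , 0ℚ) (qmul d η (qone d))))
      ≡⟨ cong (λ μ → qadd d (N , 0ℚ) (qmul d η (qadd d (ℚ.- (a ℚ.+ a) , 0ℚ) μ))) (qmul-identityʳ η) ⟩
    qadd d (N , 0ℚ) (qmul d η (qadd d (ℚ.- (a ℚ.+ a) , 0ℚ) η))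
      ≡⟨ cong (qadd d (N , 0ℚ)) (qmul-cayleyHamilton a b) ⟩
    (N ℚ.+ ℚ.- N , 0ℚ ℚ.+ 0ℚ)
      ≡⟨ cong (_, 0ℚ) (ℚP.+-inverseʳ N) ⟩
    qzero d ∎)
    where
    η = (a , b)
    N = qnorm d η

  norm≡-1⇒isUnit : ∀ a b (t : ℤ) → ℚof t ≡ a ℚ.+ a → qnorm d (a , b) ≡ ℚ.- 1ℚ → IsUnit d (a , b)
  norm≡-1⇒isUnit a b t t≡Tr N≡-1 =
      trace∧norm-integral⇒isAlgInt a b -[1+ 0 ] (ℤ.- t) (sym N≡-1) (trans (ℚof-neg t) (cong ℚ.-_ t≡Tr))
    , (ℚ.- a , b)
    , trace∧norm-integral⇒isAlgInt (ℚ.- a) b -[1+ 0 ] t (sym (trans norm-conj N≡-1)) (trans t≡Tr trace-conj)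
    , cong₂ _,_ product-fst product-snd
    where
    norm-conj : qnorm d (ℚ.- a , b) ≡ qnorm d (a , b)
    norm-conj = solve 3 (λ a b D → (:- a) :* (:- a) :- b :* b :* D := a :* a :- b :* b :* D) refl a b (dℚ d)
    trace-conj : a ℚ.+ a ≡ ℚ.- (ℚ.- a ℚ.+ ℚ.- a)
    trace-conj = solve 1 (λ a → a :+ a := :- (:- a :+ :- a)) refl a
    product-fst : a ℚ.* ℚ.- a ℚ.+ b ℚ.* b ℚ.* dℚ d ≡ 1ℚ
    product-fst = begin
      a ℚ.* ℚ.- a ℚ.+ b ℚ.* b ℚ.* dℚ d    ≡⟨ solve 3 (λ a b D → a :* :- a :+ b :* b :* D := :- (a :* a :- b :* b :* D)) refl a b (dℚ d) ⟩
      ℚ.- qnorm d (a , b)                 ≡⟨ cong ℚ.-_ N≡-1 ⟩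
      1ℚ                                  ∎
    product-snd : a ℚ.* b ℚ.+ b ℚ.* ℚ.- a ≡ 0ℚ
    product-snd = solve 2 (λ a b → a :* b :+ b :* :- a := con 0ℚ) refl a b

  qpow-kFib : ∀ a b k → a ℚ.+ a ≡ fromℕ k → qnorm d (a , b) ≡ ℚ.- 1ℚ → ∀ n →
              qpow d (a , b) (suc n) ≡ (fromℕ (kFib k n) ℚ.+ fromℕ (kFib k (suc n)) ℚ.* a , fromℕ (kFib k (suc n)) ℚ.* b)
  qpow-kFib a b k Tr≡k N≡-1 zero = begin
    qmul d (a , b) (qone d)        ≡⟨ qmul-identityʳ (a , b) ⟩
    (a , b)                        ≡⟨ sym (cong₂ _,_ (trans (ℚP.+-identityˡ _) (ℚP.*-identityˡ a)) (ℚP.*-identityˡ b)) ⟩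
    (0ℚ ℚ.+ 1ℚ ℚ.* a , 1ℚ ℚ.* b)   ∎
  qpow-kFib a b k Tr≡k N≡-1 (suc n) = begin
    qmul d (a , b) (qpow d (a , b) (suc n))   ≡⟨ cong (qmul d (a , b)) (qpow-kFib a b k Tr≡k N≡-1 n) ⟩
    qmul d (a , b) (G ℚ.+ F ℚ.* a , F ℚ.* b)  ≡⟨ cong₂ _,_ step-fst step-snd ⟩
    (F ℚ.+ E ℚ.* a , E ℚ.* b)                 ≡⟨ cong (λ x → F ℚ.+ x ℚ.* a , x ℚ.* b) (sym fromℕ-kFib) ⟩
    (F ℚ.+ fromℕ (kFib k (suc (suc n))) ℚ.* a , fromℕ (kFib k (suc (suc n))) ℚ.* b) ∎
    where
    F = fromℕ (kFib k (suc n))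
    G = fromℕ (kFib k n)
    E = (a ℚ.+ a) ℚ.* F ℚ.+ G
    fromℕ-kFib : fromℕ (kFib k (suc (suc n))) ≡ E
    fromℕ-kFib = begin
      fromℕ (k * kFib k (suc n) + kFib k n)   ≡⟨ fromℕ-+ (k * kFib k (suc n)) (kFib k n) ⟩
      fromℕ (k * kFib k (suc n)) ℚ.+ G        ≡⟨ cong (ℚ._+ G) (fromℕ-* k (kFib k (suc n))) ⟩
      fromℕ k ℚ.* F ℚ.+ G                     ≡⟨ cong (λ x → x ℚ.* F ℚ.+ G) (sym Tr≡k) ⟩
      E                                       ∎
    step-fst : a ℚ.* (G ℚ.+ F ℚ.* a) ℚ.+ b ℚ.* (F ℚ.* b) ℚ.* dℚ d ≡ F ℚ.+ E ℚ.* a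
    step-fst = begin
      a ℚ.* (G ℚ.+ F ℚ.* a) ℚ.+ b ℚ.* (F ℚ.* b) ℚ.* dℚ d
        ≡⟨ solve 5 (λ a b D F G → a :* (G :+ F :* a) :+ b :* (F :* b) :* D
                                  := F :* :- (a :* a :- b :* b :* D) :+ ((a :+ a) :* F :+ G) :* a) refl a b (dℚ d) F G ⟩
      F ℚ.* ℚ.- qnorm d (a , b) ℚ.+ E ℚ.* a   ≡⟨ cong (λ x → F ℚ.* ℚ.- x ℚ.+ E ℚ.* a) N≡-1 ⟩
      F ℚ.* 1ℚ ℚ.+ E ℚ.* a                    ≡⟨ cong (ℚ._+ E ℚ.* a) (ℚP.*-identityʳ F) ⟩
      F ℚ.+ E ℚ.* a                           ∎
    step-snd : a ℚ.* (F ℚ.* b) ℚ.+ b ℚ.* (G ℚ.+ F ℚ.* a) ≡ E ℚ.* b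
    step-snd = solve 4 (λ a b F G → a :* (F :* b) :+ b :* (G :+ F :* a) := ((a :+ a) :* F :+ G) :* b) refl a b F G

  FibDeg≡ : ∀ a b n x → b ≢ 0ℚ → proj₂ (qpow d (a , b) n) ≡ x ℚ.* b → FibDeg d (a , b) n ≡ x
  FibDeg≡ a b n x b≢0 βₙ≡xb with b ℚP.≟ 0ℚ
  ... | yes b≡0 = contradiction b≡0 b≢0
  ... | no b≢0′ = begin
    proj₂ (qpow d (a , b) n) ℚ.÷ b   ≡⟨ cong (ℚ._÷ b) βₙ≡xb ⟩
    x ℚ.* b ℚ.* ℚ.1/ b               ≡⟨ ℚP.*-assoc x b (ℚ.1/ b) ⟩
    x ℚ.* (b ℚ.* ℚ.1/ b)             ≡⟨ cong (x ℚ.*_) (ℚP.*-inverseʳ b) ⟩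
    x ℚ.* 1ℚ                         ≡⟨ ℚP.*-identityʳ x ⟩
    x                                ∎
    where instance _ = ℚ.≢-nonZero b≢0′

trace-etaOf : ∀ k → + k / 2 ℚ.+ + k / 2 ≡ fromℕ k
trace-etaOf k = begin
  + k / 2 ℚ.+ + k / 2           ≡⟨ cong (λ x → x ℚ.+ x) (n/2≡fromℕ*½ k) ⟩
  fromℕ k ℚ.* ½ ℚ.+ fromℕ k ℚ.* ½ ≡⟨ solve 1 (λ K → K :* con ½ :+ K :* con ½ := K) refl (fromℕ k) ⟩
  fromℕ k                       ∎

norm-etaOf : ∀ k d r → qnorm d (etaOf k r) ≡ (fromℕ (k * k + 4) ℚ.- fromℕ (r * r * d)) ℚ.* ¼ ℚ.- 1ℚ
norm-etaOf k d r = begin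
  qnorm d (etaOf k r)
    ≡⟨ cong₂ (λ x y → x ℚ.* x ℚ.- y ℚ.* y ℚ.* D) (n/2≡fromℕ*½ k) (n/2≡fromℕ*½ r) ⟩
  K ℚ.* ½ ℚ.* (K ℚ.* ½) ℚ.- R ℚ.* ½ ℚ.* (R ℚ.* ½) ℚ.* D
    ≡⟨ solve 3 (λ K R D → K :* con ½ :* (K :* con ½) :- R :* con ½ :* (R :* con ½) :* D
                        := (K :* K :+ con (fromℕ 4) :- R :* R :* D) :* con ¼ :- con 1ℚ) refl K R D ⟩
  (K ℚ.* K ℚ.+ fromℕ 4 ℚ.- R ℚ.* R ℚ.* D) ℚ.* ¼ ℚ.- 1ℚ
    ≡⟨ sym (cong₂ (λ x y → (x ℚ.- y) ℚ.* ¼ ℚ.- 1ℚ) fromℕ-k²+4 fromℕ-r²d) ⟩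
  (fromℕ (k * k + 4) ℚ.- fromℕ (r * r * d)) ℚ.* ¼ ℚ.- 1ℚ ∎
  where
  K = fromℕ k
  R = fromℕ r
  D = fromℕ d
  fromℕ-k²+4 : fromℕ (k * k + 4) ≡ K ℚ.* K ℚ.+ fromℕ 4
  fromℕ-k²+4 = trans (fromℕ-+ (k * k) 4) (cong (ℚ._+ fromℕ 4) (fromℕ-* k k))
  fromℕ-r²d : fromℕ (r * r * d) ≡ R ℚ.* R ℚ.* D
  fromℕ-r²d = trans (fromℕ-* (r * r) d) (cong (ℚ._* D) (fromℕ-* r r))

norm-etaOf≡-1⇔ : ∀ k d r → qnorm d (etaOf k r) ≡ ℚ.- 1ℚ ⇔ r * r * d ≡ k * k + 4
norm-etaOf≡-1⇔ k d r = mk⇔ to from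
  where
  X = fromℕ (k * k + 4)
  Y = fromℕ (r * r * d)
  to : qnorm d (etaOf k r) ≡ ℚ.- 1ℚ → r * r * d ≡ k * k + 4
  to N≡-1 = sym (fromℕ-injective (x∙y⁻¹≈ε⇒x≈y X Y (begin
    X ℚ.- Y                                          ≡⟨ solve 1 (λ z → z := con (fromℕ 4) :* (z :* con ¼ :- con 1ℚ :+ con 1ℚ)) refl (X ℚ.- Y) ⟩
    fromℕ 4 ℚ.* ((X ℚ.- Y) ℚ.* ¼ ℚ.- 1ℚ ℚ.+ 1ℚ)      ≡⟨ cong (λ n → fromℕ 4 ℚ.* (n ℚ.+ 1ℚ)) (trans (sym (norm-etaOf k d r)) N≡-1) ⟩
    0ℚ                                               ∎)))
  from : r * r * d ≡ k * k + 4 → qnorm d (etaOf k r) ≡ ℚ.- 1ℚ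
  from r²d≡k²+4 = begin
    qnorm d (etaOf k r)              ≡⟨ norm-etaOf k d r ⟩
    (X ℚ.- Y) ℚ.* ¼ ℚ.- 1ℚ           ≡⟨ cong (λ y → (X ℚ.- fromℕ y) ℚ.* ¼ ℚ.- 1ℚ) r²d≡k²+4 ⟩
    (X ℚ.- X) ℚ.* ¼ ℚ.- 1ℚ           ≡⟨ cong (λ x → x ℚ.* ¼ ℚ.- 1ℚ) (ℚP.+-inverseʳ X) ⟩
    ℚ.- 1ℚ                           ∎

kFib≡FibDeg-etaOf : ∀ k d r → 0 < r → qnorm d (etaOf k r) ≡ ℚ.- 1ℚ →
                    ∀ n → 1 ≤ n → fromℕ (kFib k n) ≡ FibDeg d (etaOf k r) n
kFib≡FibDeg-etaOf k d r r>0 N≡-1 (suc n) _ = sym (FibDeg≡ d (+ k / 2) (+ r / 2) (suc n) _ r/2≢0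
  (cong proj₂ (qpow-kFib d (+ k / 2) (+ r / 2) k (trace-etaOf k) N≡-1 n)))
  where
  r/2≢0 : + r / 2 ≢ 0ℚ
  r/2≢0 = /≢0 (λ r≡0 → ℕP.>⇒≢ r>0 (ℤP.+-injective r≡0))

theorem28 : (k : ℕ) → 0 < k →
    Σ ℕ λ d → Σ ℕ λ r →
      Good k d r
      × (∀ d′ r′ → Good k d′ r′ → d′ ≡ d × r′ ≡ r)
      × (∀ n → 1 ≤ n → (+ kFib k n) / 1 ≡ FibDeg d (etaOf k r) n)
theorem28 k _ with squareFreeFactorisation (k * k + 4) (ℕP.≤-trans (s≤s z≤n) (ℕP.m≤n+m 4 (k * k)))
... | r , d , r>0 , d>0 , sfd , r²d≡k²+4 =
  d , r , (d>0 , r>0 , sfd , unit , N≡-1) , unique , kFib≡FibDeg-etaOf k d r r>0 N≡-1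
  where
  N≡-1 : qnorm d (etaOf k r) ≡ ℚ.- 1ℚ
  N≡-1 = Equivalence.from (norm-etaOf≡-1⇔ k d r) r²d≡k²+4
  unit : IsUnit d (etaOf k r)
  unit = norm≡-1⇒isUnit d (+ k / 2) (+ r / 2) (+ k) (sym (trace-etaOf k)) N≡-1
  unique : ∀ d′ r′ → Good k d′ r′ → d′ ≡ d × r′ ≡ r
  unique d′ r′ (_ , r′>0 , sfd′ , _ , N′≡-1) = swap (squareFreeFactorisation-unique r′>0 r>0 sfd′ sfd
    (trans (Equivalence.to (norm-etaOf≡-1⇔ k d′ r′) N′≡-1) (sym r²d≡k²+4)))
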